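{- Let $r>6$, $1<d\mid r$, and $2\le j<r/2$; if $j=\frac{r-1}{2}$ assume moreover $r>9$. Let $$A_{r,d,j}=\binom{\frac rd-1}{\lfloor j/d\rfloor}\Big/\binom{r-1}{j}.$$ Then $$A_{r,d,j}(r-1)\le\begin{cases}1,& d=2,\ 2\mid j,\\ \frac{3(r-2j)}{2(r-j)},& d=2,\ 2\nmid j,\\ \frac{r-2j}{r-j},& d>2.\end{cases}$$ -}

module Defs where

open import Data.Nat using (ℕ; zero; suc; _∸_; _/_)
open import Data.Nat.Combinatorics using (_C_)
open import Data.Integer using (+_)
import Data.Rational as ℚ
open ℚ using (ℚ)

-- n / m as a rational, with the convention n / 0 = 0 (never used: the
-- denominator below is a nonzero binomial coefficient under the hypotheses).
ratio : ℕ → ℕ → ℚ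
ratio n zero    = ℚ.0ℚ
ratio n (suc m) = (+ n) ℚ./ suc m

A : (r d j : ℕ) → .{{_ : Data.Nat.NonZero d}} → ℚ
A r d j = ratio (((r / d) ∸ 1) C (j / d)) ((r ∸ 1) C j)

module Submission where

-- Clearing denominators (ratio-bound, scaled-bound) turns each claim into an inequality
-- between natural numbers; the argument then splits according to d.
--  * d = 2, r = 2(m+1).  The governing quantity is the ratio C(2m+1, 2k) / C(m, k).  Going
--    from k to k+1 multiplies it by (2(m−k)+1)/(2k+1) ≥ 1 (ratio-identity), so it is
--    nondecreasing while 2k ≤ m (ratio-mono).  Its values 2m+1 at k = 1 and (2m+1)(2m−1)/3
--    at k = 2 give the even case directly and the odd case after one more binomial step.
--  * d ≥ 3.  Rows with r ≤ 15 are checked by evaluation.  For r ≥ 16 split j = k + i with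
--    k = ⌊j/d⌋ and the row r − 1 = (r/d − 1) + N.  Vandermonde's inequality bounds
--    C(r/d−1, k)·C(N, i) by C(r−1, j); unimodality lowers C(N, i) to C(N, 2) or C(N, 3),
--    and since 3N ≥ 2r explicit polynomial estimates finish the proof.

open import Defs
open import Data.Nat
open import Data.Nat.Properties
open import Data.Nat.DivMod using (_/_; _%_; m*n/n≡m; m/n*n≤m; m/n≤m; m≡m%n+[m/n]*n; m%n<n)
open import Data.Nat.Divisibility using (_∣_; divides; _∣?_)
open import Data.Nat.Combinatorics using (_C_; nC1≡n; nCk≡nC[n∸k]; nCk+nC[k+1]≡[n+1]C[k+1])
open import Data.Nat.Tactic.RingSolver using (solve)
open import Data.List using (_∷_; [])
open import Data.Product using (_×_; _,_; ∃)
open import Data.Sum using (_⊎_; inj₁; inj₂)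
open import Data.Empty using (⊥-elim)
open import Data.Unit using (tt)
open import Relation.Nullary using (¬_; yes; no)
open import Relation.Nullary.Decidable using (Dec; _→-dec_; toWitness)
open import Relation.Binary.PropositionalEquality
import Data.Integer as ℤ
import Data.Integer.Properties as ℤP
import Data.Rational as ℚ
import Data.Rational.Properties as ℚP
import Data.Rational.Unnormalised as ℚᵘ
import Data.Rational.Unnormalised.Properties as ℚᵘP

pascal : ∀ n k → suc n C suc k ≡ n C k + n C suc k
pascal n k = sym (nCk+nC[k+1]≡[n+1]C[k+1] n k)

absorption : ∀ n k → suc k * (suc n C suc k) ≡ suc n * (n C k)
absorption n       zero    = trans (+-identityʳ _) (trans (nC1≡n (suc n)) (sym (*-identityʳ _)))
absorption zero    (suc k) = *-zeroʳ (suc (suc k))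
absorption (suc n) (suc k) = begin
  suc (suc k) * (suc (suc n) C suc (suc k))  ≡⟨ cong (suc (suc k) *_) (pascal (suc n) (suc k)) ⟩
  suc (suc k) * (c₁ + c₂)                    ≡⟨ trans (*-distribˡ-+ (suc (suc k)) c₁ c₂) (+-assoc c₁ _ _) ⟩
  c₁ + (suc k * c₁ + suc (suc k) * c₂)        ≡⟨ cong₂ (λ u v → c₁ + (u + v)) (absorption n k) (absorption n (suc k)) ⟩
  c₁ + (suc n * (n C k) + suc n * (n C suc k)) ≡⟨ cong (c₁ +_) (sym (*-distribˡ-+ (suc n) (n C k) (n C suc k))) ⟩
  c₁ + suc n * (n C k + n C suc k)            ≡⟨ cong (λ t → c₁ + suc n * t) (sym (pascal n k)) ⟩
  suc (suc n) * c₁                           ∎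
  where
  open ≡-Reasoning
  c₁ = suc n C suc k
  c₂ = suc n C suc (suc k)

binomial-step : ∀ {n} k a → k + a ≡ n → suc k * (n C suc k) ≡ a * (n C k)
binomial-step k a refl = +-cancelˡ-≡ (suc k * x) _ _ (begin
  suc k * x + suc k * y         ≡⟨ sym (*-distribˡ-+ (suc k) x y) ⟩
  suc k * (x + y)               ≡⟨ cong (suc k *_) (sym (pascal (k + a) k)) ⟩
  suc k * (suc (k + a) C suc k) ≡⟨ absorption (k + a) k ⟩
  (suc k + a) * x               ≡⟨ *-distribʳ-+ x (suc k) a ⟩
  suc k * x + a * x             ∎)
  where
  open ≡-Reasoning
  x = (k + a) C k
  y = (k + a) C suc k

C-pos : ∀ {n k} → k ≤ n → 0 < n C k
C-pos {n}     {zero}  _         = s≤s z≤n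
C-pos {suc n} {suc k} (s≤s k≤n) =
  <-≤-trans (C-pos k≤n) (subst (n C k ≤_) (sym (pascal n k)) (m≤m+n _ _))

C-mono-top : ∀ n k → n C k ≤ suc n C k
C-mono-top n zero    = ≤-refl
C-mono-top n (suc k) = subst (n C suc k ≤_) (sym (pascal n k)) (m≤n+m _ _)

-- Vandermonde's inequality C(a,p)·C(b,q) ≤ C(a+b,p+q): the left side counts
-- only the (p+q)-subsets of a disjoint union with p elements in the first part.
vandermonde-≤ : ∀ a b p q → (a C p) * (b C q) ≤ (a + b) C (p + q)
vandermonde-≤ zero    b zero    q = ≤-reflexive (+-identityʳ _)
vandermonde-≤ zero    b (suc p) q = z≤n
vandermonde-≤ (suc a) b zero    q = ≤-trans (vandermonde-≤ a b zero q) (C-mono-top (a + b) q)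
vandermonde-≤ (suc a) b (suc p) q = begin
  (suc a C suc p) * (b C q)                       ≡⟨ cong (_* (b C q)) (pascal a p) ⟩
  (a C p + a C suc p) * (b C q)                   ≡⟨ *-distribʳ-+ (b C q) (a C p) (a C suc p) ⟩
  (a C p) * (b C q) + (a C suc p) * (b C q)       ≤⟨ +-mono-≤ (vandermonde-≤ a b p q) (vandermonde-≤ a b (suc p) q) ⟩
  (a + b) C (p + q) + (a + b) C suc (p + q)       ≡⟨ sym (pascal (a + b) (p + q)) ⟩
  suc (a + b) C suc (p + q)                       ∎
  where open ≤-Reasoning

C-rising : ∀ n k → 2 * k < n → n C k ≤ n C suc k
C-rising n k 2k<n with m≤n⇒∃[o]m+o≡n (≤-trans (m≤m+n k (k + 0)) (<⇒≤ 2k<n))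
... | a , refl = *-cancelˡ-≤ (suc k) (begin
  suc k * ((k + a) C k) ≤⟨ *-monoˡ-≤ ((k + a) C k) k<a ⟩
  a * ((k + a) C k)     ≡⟨ sym (binomial-step k a refl) ⟩
  suc k * ((k + a) C suc k) ∎)
  where
  open ≤-Reasoning
  k<a : k < a
  k<a = +-cancelˡ-< k k a (subst (_< k + a) (cong (k +_) (+-identityʳ k)) 2k<n)

C-mono-lower : ∀ n {s i} → s ≤ i → 2 * i ≤ n → n C s ≤ n C i
C-mono-lower n {i = zero}      z≤n   _    = ≤-refl
C-mono-lower n {s} {suc i} s≤1+i 2i+2≤n with m≤n⇒m<n∨m≡n s≤1+i
... | inj₂ refl      = ≤-refl
... | inj₁ (s≤s s≤i) = ≤-trans (C-mono-lower n s≤i (<⇒≤ 2i<n)) (C-rising n i 2i<n)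
  where
  2i<n : 2 * i < n
  2i<n = <-≤-trans (*-monoʳ-< 2 (n<1+n i)) 2i+2≤n

-- Unimodality: C(N,s) ≤ C(N,i) whenever s ≤ i and i + s ≤ N
-- (reduce to the lower half using the symmetry C(N,i) = C(N,N−i)).
C-unimodal : ∀ N {s i} → s ≤ i → i + s ≤ N → N C s ≤ N C i
C-unimodal N {s} {i} s≤i i+s≤N with m≤n⇒∃[o]m+o≡n (≤-trans (m≤m+n i s) i+s≤N)
... | t , refl = by-half (≤-total i t)
  where
  open ≤-Reasoning
  s≤t : s ≤ t
  s≤t = +-cancelˡ-≤ i s t i+s≤N
  twice : ∀ x → 2 * x ≡ x + x
  twice x = cong (x +_) (+-identityʳ x)
  by-half : i ≤ t ⊎ t ≤ i → (i + t) C s ≤ (i + t) C i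
  by-half (inj₁ i≤t) = C-mono-lower (i + t) s≤i (subst (_≤ i + t) (sym (twice i)) (+-monoʳ-≤ i i≤t))
  by-half (inj₂ t≤i) = begin
    (i + t) C s           ≤⟨ C-mono-lower (i + t) s≤t (subst (_≤ i + t) (sym (twice t)) (+-monoˡ-≤ t t≤i)) ⟩
    (i + t) C t           ≡⟨ nCk≡nC[n∸k] (m≤n+m t i) ⟩
    (i + t) C (i + t ∸ t) ≡⟨ cong ((i + t) C_) (m+n∸n≡m i t) ⟩
    (i + t) C i           ∎

-- Three consecutive ratio relations combine into one cross-ratio identity
-- (pure algebra; instantiated below with binomial coefficients).
cross-ratio : ∀ k a X X′ Y₀ Y₁ Y₂ →
  suc k * X′ ≡ a * X → suc (k * 2) * Y₁ ≡ suc (a * 2) * Y₀ → suc k * 2 * Y₂ ≡ a * 2 * Y₁ →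
  X′ * Y₀ * suc (a * 2) ≡ X * Y₂ * suc (k * 2)
cross-ratio k a X X′ Y₀ Y₁ Y₂ e₁ e₂ e₃ = *-cancelˡ-≡ _ _ (suc k * 2) (begin
  suc k * 2 * (X′ * Y₀ * suc (a * 2))     ≡⟨ solve (k ∷ a ∷ X′ ∷ Y₀ ∷ []) ⟩
  2 * (suc k * X′) * (suc (a * 2) * Y₀)    ≡⟨ cong₂ (λ u v → 2 * u * v) e₁ (sym e₂) ⟩
  2 * (a * X) * (suc (k * 2) * Y₁)         ≡⟨ solve (k ∷ a ∷ X ∷ Y₁ ∷ []) ⟩
  X * suc (k * 2) * (a * 2 * Y₁)           ≡⟨ cong (X * suc (k * 2) *_) (sym e₃) ⟩
  X * suc (k * 2) * (suc k * 2 * Y₂)       ≡⟨ solve (k ∷ X ∷ Y₂ ∷ []) ⟩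
  suc k * 2 * (X * Y₂ * suc (k * 2))       ∎)
  where open ≡-Reasoning

RatioAtLeast : (m k W c : ℕ) → Set
RatioAtLeast m k W c = (m C k) * W ≤ c * (suc (m * 2) C (k * 2))

-- Exact growth of that ratio from k to k+1 (m = k + a): it is multiplied by (2a+1)/(2k+1).
ratio-identity : ∀ k a → let m = k + a; n = suc (m * 2) in
  (m C suc k) * (n C (k * 2)) * suc (a * 2) ≡ (m C k) * (n C (suc k * 2)) * suc (k * 2)
ratio-identity k a = cross-ratio k a _ _ _ _ _
  (binomial-step k a refl)
  (binomial-step (k * 2) (suc (a * 2)) split₁)
  (binomial-step (suc (k * 2)) (a * 2) split₂)
  where
  split₁ : k * 2 + suc (a * 2) ≡ suc ((k + a) * 2)
  split₁ = solve (k ∷ a ∷ [])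
  split₂ : suc (k * 2) + a * 2 ≡ suc ((k + a) * 2)
  split₂ = solve (k ∷ a ∷ [])

transfer-≤ : ∀ X X′ Y₀ Y₂ p q W c → X′ * Y₀ * q ≡ X * Y₂ * p → p ≤ q → 0 < Y₀ → 0 < q →
  X * W ≤ c * Y₀ → X′ * W ≤ c * Y₂
transfer-≤ X X′ Y₀ Y₂ p q W c eq p≤q 0<Y₀ 0<q XW≤cY₀ =
  *-cancelʳ-≤ _ _ (Y₀ * q) {{m*n≢0 Y₀ q {{>-nonZero 0<Y₀}} {{>-nonZero 0<q}}}} (begin
    X′ * W * (Y₀ * q)    ≡⟨ solve (X′ ∷ W ∷ Y₀ ∷ q ∷ []) ⟩
    W * (X′ * Y₀ * q)    ≡⟨ cong (W *_) eq ⟩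
    W * (X * Y₂ * p)     ≡⟨ solve (W ∷ X ∷ Y₂ ∷ p ∷ []) ⟩
    X * W * (Y₂ * p)     ≤⟨ *-mono-≤ XW≤cY₀ (*-monoʳ-≤ Y₂ p≤q) ⟩
    c * Y₀ * (Y₂ * q)    ≡⟨ solve (c ∷ Y₀ ∷ Y₂ ∷ q ∷ []) ⟩
    c * Y₂ * (Y₀ * q)    ∎)
  where open ≤-Reasoning

ratio-step : ∀ {W c} k a → k ≤ a → RatioAtLeast (k + a) k W c → RatioAtLeast (k + a) (suc k) W c
ratio-step {W} {c} k a k≤a = transfer-≤
  ((k + a) C k) ((k + a) C suc k) (suc ((k + a) * 2) C (k * 2)) (suc ((k + a) * 2) C (suc k * 2))
  (suc (k * 2)) (suc (a * 2)) W c
  (ratio-identity k a) (s≤s (*-monoˡ-≤ 2 k≤a))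
  (C-pos (m≤n⇒m≤1+n (*-monoˡ-≤ 2 (m≤m+n k a)))) z<s

ratio-mono : ∀ {W c} m {k k′} → k ≤ k′ → 2 * k′ ≤ m → RatioAtLeast m k W c → RatioAtLeast m k′ W c
ratio-mono m {k′ = zero} z≤n _ bound = bound
ratio-mono {W} {c} m {k} {suc k′} k≤1+k′ 2k′+2≤m bound with m≤n⇒m<n∨m≡n k≤1+k′
... | inj₂ refl      = bound
... | inj₁ (s≤s k≤k′) = step (ratio-mono {W} {c} m k≤k′ 2k′≤m bound)
  where
  2k′≤m : 2 * k′ ≤ m
  2k′≤m = ≤-trans (*-monoʳ-≤ 2 (n≤1+n k′)) 2k′+2≤m
  step : RatioAtLeast m k′ W c → RatioAtLeast m (suc k′) W c
  step with m≤n⇒∃[o]m+o≡n (≤-trans (m≤m+n k′ (k′ + 0)) 2k′≤m)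
  ... | a , refl = ratio-step {W} {c} k′ a (+-cancelˡ-≤ k′ k′ a (subst (_≤ k′ + a) (cong (k′ +_) (+-identityʳ k′)) 2k′≤m))

C-2-odd-row : ∀ m → suc (m * 2) C 2 ≡ m * suc (m * 2)
C-2-odd-row m = begin
  n C 2                ≡⟨ sym (*-identityʳ (n C 2)) ⟩
  (n C 2) * 1          ≡⟨ cong (_* 1) (sym (*-identityˡ (n C 2))) ⟩
  1 * (n C 2) * 1      ≡⟨ sym (ratio-identity 0 m) ⟩
  (m C 1) * 1 * n      ≡⟨ cong (_* n) (trans (*-identityʳ (m C 1)) (nC1≡n m)) ⟩
  m * n                ∎
  where
  open ≡-Reasoning
  n = suc (m * 2)

ratio-at-1 : ∀ m → RatioAtLeast m 1 (suc (m * 2)) 1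
ratio-at-1 m = ≤-reflexive (begin
  (m C 1) * n     ≡⟨ cong (_* n) (nC1≡n m) ⟩
  m * n           ≡⟨ sym (C-2-odd-row m) ⟩
  n C 2           ≡⟨ sym (*-identityˡ (n C 2)) ⟩
  1 * (n C 2)     ∎)
  where
  open ≡-Reasoning
  n = suc (m * 2)

ratio-at-2 : ∀ a → RatioAtLeast (suc a) 2 (suc (suc a * 2) * suc (a * 2)) 3
ratio-at-2 a = ≤-reflexive (cancel-m ((suc a) C 2) (n C 2) (n C 4) (C-2-odd-row (suc a))
  (subst (λ x → ((suc a) C 2) * (n C 2) * suc (a * 2) ≡ x * (n C 4) * 3) (nC1≡n (suc a)) (ratio-identity 1 a)))
  where
  n = suc (suc a * 2)
  cancel-m : ∀ X₂ Y₂ Y₄ → Y₂ ≡ suc a * suc (suc a * 2) → X₂ * Y₂ * suc (a * 2) ≡ suc a * Y₄ * 3 →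
    X₂ * (suc (suc a * 2) * suc (a * 2)) ≡ 3 * Y₄
  cancel-m X₂ Y₂ Y₄ refl eq = *-cancelˡ-≡ _ _ (suc a) (begin
    suc a * (X₂ * (suc (suc a * 2) * suc (a * 2)))   ≡⟨ solve (a ∷ X₂ ∷ []) ⟩
    X₂ * (suc a * suc (suc a * 2)) * suc (a * 2)     ≡⟨ eq ⟩
    suc a * Y₄ * 3                                   ≡⟨ solve (a ∷ Y₄ ∷ []) ⟩
    suc a * (3 * Y₄)                                 ∎)
    where open ≡-Reasoning

even-case : ∀ m k → 1 ≤ k → k * 2 ≤ m → (m C k) * suc (m * 2) ≤ suc (m * 2) C (k * 2)
even-case m k 1≤k 2k≤m = subst ((m C k) * suc (m * 2) ≤_) (*-identityˡ _)
  (ratio-mono {c = 1} m 1≤k (subst (_≤ m) (*-comm k 2) 2k≤m) (ratio-at-1 m))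

-- Core of the odd case j = 2k+1 (d = 2), with m = k + a and a = k + b:
-- C(m,k)·(2m+1)·(2k+1) ≤ 3b·C(2m+1,2k).  For k = 1 the ratio bound at 1 suffices;
-- for k ≥ 2 use the bound at 2, which is (2m+1)(2m−1)/3, and 2k+1 ≤ 2m−1.
odd-core : ∀ k b → 1 ≤ k → 1 ≤ b → let m = k + (k + b) in
  (m C k) * suc (m * 2) * suc (k * 2) ≤ 3 * b * (suc (m * 2) C (k * 2))
odd-core (suc zero) b _ 1≤b = begin
  (m C 1) * n * 3      ≤⟨ *-monoˡ-≤ 3 (ratio-at-1 m) ⟩
  1 * (n C 2) * 3      ≡⟨ trans (cong (_* 3) (*-identityˡ (n C 2))) (*-comm (n C 2) 3) ⟩
  3 * (n C 2)          ≤⟨ *-monoˡ-≤ (n C 2) (*-monoʳ-≤ 3 1≤b) ⟩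
  3 * b * (n C 2)      ∎
  where
  open ≤-Reasoning
  m = suc (suc b)
  n = suc (m * 2)
odd-core k@(suc (suc k₀)) b _ 1≤b = begin
  (m C k) * n * suc (k * 2)           ≤⟨ *-monoʳ-≤ ((m C k) * n) 2k+1≤2m−1 ⟩
  (m C k) * n * suc (a′ * 2)          ≡⟨ *-assoc (m C k) n (suc (a′ * 2)) ⟩
  (m C k) * (n * suc (a′ * 2))        ≤⟨ ratio-mono {c = 3} m (s≤s (s≤s z≤n)) 2k≤m (ratio-at-2 a′) ⟩
  3 * (n C (k * 2))                   ≤⟨ *-monoˡ-≤ (n C (k * 2)) (*-monoʳ-≤ 3 1≤b) ⟩
  3 * b * (n C (k * 2))               ∎
  where
  open ≤-Reasoning
  a′ = suc k₀ + (k + b)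
  m = suc a′
  n = suc (m * 2)
  2k≤m : 2 * k ≤ m
  2k≤m = subst (_≤ m) (cong (k +_) (sym (+-identityʳ k))) (+-monoʳ-≤ k (m≤m+n k b))
  2k+1≤2m−1 : suc (k * 2) ≤ suc (a′ * 2)
  2k+1≤2m−1 = s≤s (*-monoˡ-≤ 2 (s≤s (≤-trans (n≤1+n (suc k₀)) (≤-trans (m≤m+n k b) (m≤n+m (k + b) k₀)))))

-- Odd j = 2k+1 (d = 2), with m = k + a and a = k + b, so r − j = 2a+1 and r − 2j = 2b:
-- C(m,k)·(2m+1)·2(2a+1) ≤ 3·2b·C(2m+1,2k+1).
odd-case : ∀ k b → 1 ≤ k → 1 ≤ b → let a = k + b; m = k + a; n = suc (m * 2) in
  (m C k) * n * (2 * suc (a * 2)) ≤ 3 * (b * 2) * (n C suc (k * 2))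
odd-case k b 1≤k 1≤b = *-cancelʳ-≤ _ _ (suc (k * 2))
  (scale (suc (k * 2)) (suc ((k + b) * 2)) ((k + (k + b)) C k) (suc ((k + (k + b)) * 2)) _ _
    (binomial-step (k * 2) (suc ((k + b) * 2)) split) (odd-core k b 1≤k 1≤b))
  where
  split : k * 2 + suc ((k + b) * 2) ≡ suc ((k + (k + b)) * 2)
  split = solve (k ∷ b ∷ [])
  -- multiply the core bound by 2q and use p·C(n,2k+1) = q·C(n,2k)
  scale : ∀ p q X n Y₀ Y₁ → p * Y₁ ≡ q * Y₀ → X * n * p ≤ 3 * b * Y₀ →
    X * n * (2 * q) * p ≤ 3 * (b * 2) * Y₁ * p
  scale p q X n Y₀ Y₁ eq core = begin
    X * n * (2 * q) * p     ≡⟨ solve (p ∷ q ∷ X ∷ n ∷ []) ⟩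
    2 * q * (X * n * p)     ≤⟨ *-monoʳ-≤ (2 * q) core ⟩
    2 * q * (3 * b * Y₀)    ≡⟨ solve (q ∷ b ∷ Y₀ ∷ []) ⟩
    3 * (b * 2) * (q * Y₀)  ≡⟨ cong (3 * (b * 2) *_) (sym eq) ⟩
    3 * (b * 2) * (p * Y₁)  ≡⟨ solve (b ∷ p ∷ Y₁ ∷ []) ⟩
    3 * (b * 2) * Y₁ * p    ∎
    where open ≤-Reasoning

≤-surplus : ∀ {a b} c → a + c ≡ b → a ≤ b
≤-surplus {a} c refl = m≤m+n a c

-- The two polynomial estimates behind the case d ≥ 3, for a row of length
-- N = n + 2 with 2R ≤ 3n + 4 and n ≥ 9:  R(R+4) ≤ 3·(n+1)(n+2) = 6·C(N,2).
poly-2 : ∀ R n → 9 ≤ n → 2 * R ≤ 3 * n + 4 → R * (R + 4) ≤ 3 * (suc n * suc (suc n))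
poly-2 R n 9≤n 2R≤ with m≤n⇒∃[o]m+o≡n 9≤n
... | t , refl = *-cancelˡ-≤ 4 (begin
  4 * (R * (R + 4))                     ≡⟨ solve (R ∷ []) ⟩
  2 * R * (2 * R + 8)                   ≤⟨ *-mono-≤ 2R≤ (+-monoˡ-≤ 8 2R≤) ⟩
  (3 * n + 4) * (3 * n + 4 + 8)         ≤⟨ ≤-surplus (111 + 42 * t + 3 * (t * t)) (solve (t ∷ [])) ⟩
  4 * (3 * (suc n * suc (suc n)))       ∎)
  where open ≤-Reasoning

-- … and 3R(R+2) ≤ n(n+1)(n+2) = 6·C(N,3).
poly-3 : ∀ R n → 9 ≤ n → 2 * R ≤ 3 * n + 4 → 3 * (R * (R + 2)) ≤ n * suc n * suc (suc n)
poly-3 R n 9≤n 2R≤ with m≤n⇒∃[o]m+o≡n 9≤n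
... | t , refl = *-cancelˡ-≤ 4 (begin
  4 * (3 * (R * (R + 2)))               ≡⟨ solve (R ∷ []) ⟩
  3 * (2 * R * (2 * R + 4))             ≤⟨ *-monoʳ-≤ 3 (*-mono-≤ 2R≤ (+-monoˡ-≤ 4 2R≤)) ⟩
  3 * ((3 * n + 4) * (3 * n + 4 + 4))   ≤⟨ ≤-surplus (705 + 602 * t + 93 * (t * t) + 4 * (t * t * t)) (solve (t ∷ [])) ⟩
  4 * (n * suc n * suc (suc n))         ∎)
  where open ≤-Reasoning

C-2-formula : ∀ n → 2 * (suc (suc n) C 2) ≡ suc n * suc (suc n)
C-2-formula n = trans (binomial-step 1 (suc n) refl) (cong (suc n *_) (nC1≡n (suc (suc n))))

C-3-formula : ∀ n → 6 * (suc (suc n) C 3) ≡ n * suc n * suc (suc n)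
C-3-formula n = regroup {suc (suc n) C 3} (binomial-step 2 n refl) (C-2-formula n)
  where
  regroup : ∀ {X₃ X₂} → 3 * X₃ ≡ n * X₂ → 2 * X₂ ≡ suc n * suc (suc n) → 6 * X₃ ≡ n * suc n * suc (suc n)
  regroup {X₃} {X₂} e₃ e₂ = begin
    6 * X₃         ≡⟨ solve (X₃ ∷ []) ⟩
    2 * (3 * X₃)   ≡⟨ cong (2 *_) e₃ ⟩
    2 * (n * X₂)   ≡⟨ solve (n ∷ X₂ ∷ []) ⟩
    n * (2 * X₂)   ≡⟨ cong (n *_) e₂ ⟩
    n * (suc n * suc (suc n)) ≡⟨ sym (*-assoc n (suc n) (suc (suc n))) ⟩
    n * suc n * suc (suc n) ∎
    where open ≡-Reasoning

-- How the target R·(R+1+u) compares with the estimates above, depending on u = r − 2j: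
-- for u ≥ 3 it is at most u·R(R+4)/3, for every u ≥ 1 at most u·R(R+2).
linear-≥3 : ∀ R v → 3 * (R * (suc R + (3 + v))) ≤ (3 + v) * (R * (R + 4))
linear-≥3 R v = begin
  3 * (R * (suc R + (3 + v)))            ≡⟨ solve (R ∷ v ∷ []) ⟩
  3 * (R * (R + 4)) + v * (R * 3)        ≤⟨ +-monoʳ-≤ (3 * (R * (R + 4))) (*-monoʳ-≤ v (*-monoʳ-≤ R 3≤4+R)) ⟩
  3 * (R * (R + 4)) + v * (R * (4 + R))  ≡⟨ solve (R ∷ v ∷ []) ⟩
  (3 + v) * (R * (R + 4))                ∎
  where
  open ≤-Reasoning
  3≤4+R : 3 ≤ 4 + R
  3≤4+R = ≤-trans (n≤1+n 3) (m≤m+n 4 R)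

linear-≥1 : ∀ R v → 3 * (R * (suc R + suc v)) ≤ suc v * (3 * (R * (R + 2)))
linear-≥1 R v = begin
  3 * (R * (suc R + suc v))                  ≡⟨ solve (R ∷ v ∷ []) ⟩
  3 * (R * (R + 2)) + v * (R * 3)            ≤⟨ +-monoʳ-≤ (3 * (R * (R + 2))) (*-monoʳ-≤ v (*-monoʳ-≤ R (m≤m*n 3 (2 + R)))) ⟩
  3 * (R * (R + 2)) + v * (R * (3 * (2 + R))) ≡⟨ solve (R ∷ v ∷ []) ⟩
  suc v * (3 * (R * (R + 2)))                ∎
  where open ≤-Reasoning

-- Key estimate for d ≥ 3 and r ≥ 16 (R = r − 1, u = r − 2j, N ≥ 2r/3):
-- R·(R+1+u) ≤ 2u·C(N,i), using C(N,i) ≥ C(N,2) when u ≥ 3 and C(N,i) ≥ C(N,3) when u ≤ 2.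
key-large : ∀ R N i u → 15 ≤ R → 2 * suc R ≤ 3 * N → 2 ≤ i → i + 3 ≤ N → (u ≤ 2 → 3 ≤ i) → 1 ≤ u →
  R * (suc R + u) ≤ 2 * u * (N C i)
key-large R N i u 15≤R 2r≤3N 2≤i i+3≤N small-u⇒3≤i 1≤u
  with m≤n⇒∃[o]m+o≡n (≤-trans (m≤n+m 2 i) (≤-trans (+-monoʳ-≤ i (n≤1+n 2)) i+3≤N))
... | n , refl = by-cases u small-u⇒3≤i 1≤u
  where
  2R≤3n+4 : 2 * R ≤ 3 * n + 4
  2R≤3n+4 = +-cancelʳ-≤ 2 (2 * R) (3 * n + 4)
    (subst₂ _≤_ 2r-form 3N-form 2r≤3N)
    where
    2r-form : 2 * suc R ≡ 2 * R + 2
    2r-form = solve (R ∷ [])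
    3N-form : 3 * (2 + n) ≡ 3 * n + 4 + 2
    3N-form = solve (n ∷ [])
  9≤n : 9 ≤ n
  9≤n = *-cancelˡ-< 3 8 n (+-cancelʳ-≤ 4 25 (3 * n) (≤-trans (n≤1+n 29) (≤-trans (*-monoʳ-≤ 2 15≤R) 2R≤3n+4)))
  finish : ∀ {u} s → s ≤ i → i + s ≤ 2 + n → 3 * (R * (suc R + u)) ≤ u * (6 * ((2 + n) C s)) →
    R * (suc R + u) ≤ 2 * u * ((2 + n) C i)
  finish {u} s s≤i i+s≤N bound = *-cancelˡ-≤ 3 (begin
    3 * (R * (suc R + u))        ≤⟨ bound ⟩
    u * (6 * ((2 + n) C s))      ≤⟨ *-monoʳ-≤ u (*-monoʳ-≤ 6 (C-unimodal (2 + n) s≤i i+s≤N)) ⟩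
    u * (6 * ((2 + n) C i))      ≡⟨ regroup ((2 + n) C i) ⟩
    3 * (2 * u * ((2 + n) C i))  ∎)
    where
    open ≤-Reasoning
    regroup : ∀ Y → u * (6 * Y) ≡ 3 * (2 * u * Y)
    regroup Y = solve (u ∷ Y ∷ [])
  via-C3 : ∀ v → 3 * (R * (suc R + suc v)) ≤ suc v * (6 * ((2 + n) C 3))
  via-C3 v = begin
    3 * (R * (suc R + suc v))      ≤⟨ linear-≥1 R v ⟩
    suc v * (3 * (R * (R + 2)))    ≤⟨ *-monoʳ-≤ (suc v) (poly-3 R n 9≤n 2R≤3n+4) ⟩
    suc v * (n * suc n * suc (suc n)) ≡⟨ cong (suc v *_) (sym (C-3-formula n)) ⟩
    suc v * (6 * ((2 + n) C 3))    ∎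
    where open ≤-Reasoning
  by-cases : ∀ u → (u ≤ 2 → 3 ≤ i) → 1 ≤ u → R * (suc R + u) ≤ 2 * u * ((2 + n) C i)
  by-cases 1                   small⇒ _ = finish 3 (small⇒ (s≤s z≤n)) i+3≤N (via-C3 0)
  by-cases 2                   small⇒ _ = finish 3 (small⇒ (s≤s (s≤s z≤n))) i+3≤N (via-C3 1)
  by-cases (suc (suc (suc v))) _      _ = finish 2 2≤i (≤-trans (+-monoʳ-≤ i (n≤1+n 2)) i+3≤N) (begin
    3 * (R * (suc R + (3 + v)))       ≤⟨ linear-≥3 R v ⟩
    (3 + v) * (R * (R + 4))           ≤⟨ *-monoʳ-≤ (3 + v) (poly-2 R n 9≤n 2R≤3n+4) ⟩
    (3 + v) * (3 * (suc n * suc (suc n))) ≡⟨ cong (λ x → (3 + v) * (3 * x)) (sym (C-2-formula n)) ⟩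
    (3 + v) * (3 * (2 * ((2 + n) C 2))) ≡⟨ cong ((3 + v) *_) (sym (*-assoc 3 2 ((2 + n) C 2))) ⟩
    (3 + v) * (6 * ((2 + n) C 2))      ∎)
    where open ≤-Reasoning

two≤i : ∀ k i → 2 * k ≤ i → 2 ≤ k + i → 2 ≤ i
two≤i zero    i _    2≤i = 2≤i
two≤i (suc k) i 2k≤i _   = ≤-trans (*-monoʳ-≤ 2 (s≤s z≤n)) 2k≤i

-- The case d ≥ 3, r = R + 1 ≥ 16, after splitting j = k + i with k = ⌊j/d⌋ (so 2k ≤ i)
-- and the row R = m′ + N (m′ = r/d − 1, so 3N ≥ 2r).  Vandermonde reduces the claim to
-- key-large, whose remaining hypotheses are elementary consequences.
large-case : ∀ R m′ N k i u → R ≡ m′ + N → 15 ≤ R → 2 * suc R ≤ 3 * N → 2 * k ≤ i → 2 ≤ k + i →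
  2 * (k + i) + u ≡ suc R → 1 ≤ u → (m′ C k) * R * (k + i + u) ≤ u * (R C (k + i))
large-case R m′ N k i u R≡m′+N 15≤R 2r≤3N 2k≤i 2≤j 2j+u≡r 1≤u = begin
  (m′ C k) * R * (k + i + u)     ≡⟨ *-assoc (m′ C k) R (k + i + u) ⟩
  (m′ C k) * (R * (k + i + u))   ≤⟨ *-monoʳ-≤ (m′ C k) key ⟩
  (m′ C k) * (u * (N C i))       ≡⟨ x[uy]≡u[xy] (m′ C k) u (N C i) ⟩
  u * ((m′ C k) * (N C i))       ≤⟨ *-monoʳ-≤ u vandermonde ⟩
  u * (R C (k + i))              ∎
  where
  open ≤-Reasoning
  x[uy]≡u[xy] : ∀ x u y → x * (u * y) ≡ u * (x * y)
  x[uy]≡u[xy] x u y = solve (x ∷ u ∷ y ∷ [])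
  vandermonde : (m′ C k) * (N C i) ≤ R C (k + i)
  vandermonde = subst (λ x → (m′ C k) * (N C i) ≤ x C (k + i)) (sym R≡m′+N) (vandermonde-≤ m′ N k i)
  2j≤R : 2 * (k + i) ≤ R
  2j≤R = ≤-pred (subst (suc (2 * (k + i)) ≤_) 2j+u≡r
    (subst (_≤ 2 * (k + i) + u) (+-comm (2 * (k + i)) 1) (+-monoʳ-≤ (2 * (k + i)) 1≤u)))
  2j≤3i : 2 * (k + i) ≤ 3 * i
  2j≤3i = subst₂ _≤_ (sym (*-distribˡ-+ 2 k i)) (i+2i≡3i i) (+-monoˡ-≤ (2 * i) 2k≤i)
    where
    i+2i≡3i : ∀ i → i + 2 * i ≡ 3 * i
    i+2i≡3i i = solve (i ∷ [])
  i+3≤N : i + 3 ≤ N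
  i+3≤N = *-cancelˡ-≤ 6 (begin
    6 * (i + 3)              ≤⟨ ≤-surplus (6 * k) (solve (i ∷ k ∷ [])) ⟩
    3 * (2 * (k + i)) + 18   ≤⟨ +-monoˡ-≤ 18 (*-monoʳ-≤ 3 2j≤R) ⟩
    3 * R + 18               ≤⟨ +-monoʳ-≤ (3 * R) (+-monoʳ-≤ 4 (≤-trans (n≤1+n 14) 15≤R)) ⟩
    3 * R + (4 + R)          ≡⟨ solve (R ∷ []) ⟩
    2 * (2 * suc R)          ≤⟨ *-monoʳ-≤ 2 2r≤3N ⟩
    2 * (3 * N)              ≡⟨ sym (*-assoc 2 3 N) ⟩
    6 * N                    ∎)
  small-u⇒3≤i : u ≤ 2 → 3 ≤ i
  small-u⇒3≤i u≤2 = *-cancelˡ-< 3 2 i (≤-trans (m≤m+n 7 7) (≤-trans 14≤2j 2j≤3i))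
    where
    14≤2j : 14 ≤ 2 * (k + i)
    14≤2j = +-cancelʳ-≤ 2 14 (2 * (k + i))
      (≤-trans (s≤s 15≤R) (≤-trans (≤-reflexive (sym 2j+u≡r)) (+-monoʳ-≤ (2 * (k + i)) u≤2)))
  key : R * (k + i + u) ≤ u * (N C i)
  key = *-cancelˡ-≤ 2 (begin
    2 * (R * (k + i + u))      ≡⟨ solve (R ∷ k ∷ i ∷ u ∷ []) ⟩
    R * (2 * (k + i) + u + u)  ≡⟨ cong (λ x → R * (x + u)) 2j+u≡r ⟩
    R * (suc R + u)            ≤⟨ key-large R N i u 15≤R 2r≤3N (two≤i k i 2k≤i 2≤j) i+3≤N small-u⇒3≤i 1≤u ⟩
    2 * u * (N C i)            ≡⟨ *-assoc 2 u (N C i) ⟩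
    2 * (u * (N C i))          ∎)

SmallClaim : ℕ → ℕ → ℕ → Set
SmallClaim r e j = (3 + e) ∣ r → 6 < r → 2 ≤ j → 2 * j < r → (2 * j ≡ r ∸ 1 → 9 < r) →
  ((r / (3 + e) ∸ 1) C (j / (3 + e))) * (r ∸ 1) * (r ∸ j) ≤ (r ∸ 2 * j) * ((r ∸ 1) C j)

small-claim? : ∀ r e j → Dec (SmallClaim r e j)
small-claim? r e j = (3 + e) ∣? r →-dec (6 <? r →-dec (2 ≤? j →-dec (2 * j <? r →-dec
  ((2 * j ≟ r ∸ 1 →-dec 9 <? r) →-dec (_ ≤? _)))))

-- Evaluation verifies it for all r ≤ 15 (hence d = 3 + e ≤ 15).
all-small : ∀ {r} → r < 16 → ∀ {e} → e < 13 → ∀ {j} → j < 16 → SmallClaim r e j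
all-small = toWitness {a? = allUpTo? (λ r → allUpTo? (λ e → allUpTo? (small-claim? r e) 16) 13) 16} tt

-- j < r/2 gives j < r, hence j ≤ r − 1 (so that C(r−1, j) > 0).
j<r : ∀ {j r} → 2 * j < r → j < r
j<r {j} 2j<r = ≤-<-trans (m≤m+n j (j + 0)) 2j<r

below-half : ∀ {j r} → 2 * j < r → j ≤ r ∸ 1
below-half {r = suc r} 2j<r = ≤-pred (j<r 2j<r)

halve-< : ∀ a b → 2 * a < b * 2 → a < b
halve-< a b 2a<2b = *-cancelˡ-< 2 a b (subst (2 * a <_) (*-comm b 2) 2a<2b)

∸-from-sum : ∀ {x y z} → x ≡ y + z → x ∸ y ≡ z
∸-from-sum {y = y} {z} refl = m+n∸m≡n y z

-- Exact division, in a form usable by rewrite.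
*-/-cancel : ∀ m d → m * suc d / suc d ≡ m
*-/-cancel m d = m*n/n≡m m (suc d)

odd-form : ∀ j → ¬ 2 ∣ j → j ≡ suc (j / 2 * 2)
odd-form j ¬2∣j with j % 2 | m%n<n j 2 | m≡m%n+[m/n]*n j 2
... | 0           | _               | j≡ = ⊥-elim (¬2∣j (divides (j / 2) j≡))
... | 1           | _               | j≡ = j≡
... | suc (suc _) | s≤s (s≤s ())    | _

even-cross : ∀ m j → 2 ≤ j → 2 * j < m * 2 → 2 ∣ j →
  ((m * 2 / 2 ∸ 1) C (j / 2)) * (m * 2 ∸ 1) * 1 ≤ 1 * ((m * 2 ∸ 1) C j)
even-cross (suc m′) _ _ 2j<r (divides (suc q′) refl)
  rewrite *-/-cancel (suc m′) 1 | *-/-cancel (suc q′) 1 =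
  subst₂ _≤_ (sym (*-identityʳ _)) (sym (*-identityˡ _))
    (even-case m′ (suc q′) (s≤s z≤n) (≤-pred (halve-< (suc q′ * 2) (suc m′) 2j<r)))

odd-room : ∀ k m′ → 2 * suc (k * 2) < suc m′ * 2 → ∃ λ b → 1 ≤ b × k + (k + b) ≡ m′
odd-room k m′ 2j<r with m≤n⇒∃[o]m+o≡n (≤-pred (halve-< (suc (k * 2)) (suc m′) 2j<r))
... | e , 2k+1+e≡m′ = suc e , s≤s z≤n , trans (regroup k e) 2k+1+e≡m′
  where
  regroup : ∀ k e → k + (k + suc e) ≡ suc (k * 2) + e
  regroup k e = solve (k ∷ e ∷ [])

odd-cross : ∀ m k j → j ≡ suc (k * 2) → 2 ≤ j → 2 * j < m * 2 →
  ((m * 2 / 2 ∸ 1) C k) * (m * 2 ∸ 1) * (2 * (m * 2 ∸ j)) ≤ 3 * (m * 2 ∸ 2 * j) * ((m * 2 ∸ 1) C j)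
odd-cross (suc m′) zero     _ refl (s≤s ()) _
odd-cross (suc m′) (suc k′) _ refl _ 2j<r rewrite *-/-cancel (suc m′) 1 with odd-room (suc k′) m′ 2j<r
... | b , 1≤b , refl = subst₂ (λ x y → X * n * (2 * x) ≤ 3 * y * (n C suc (k * 2)))
  (sym (∸-from-sum {y = suc (k * 2)} (r-split₁ k b))) (sym (∸-from-sum {y = 2 * suc (k * 2)} (r-split₂ k b)))
  (odd-case k b (s≤s z≤n) 1≤b)
  where
  k = suc k′
  X = (k + (k + b)) C k
  n = suc ((k + (k + b)) * 2)
  r-split₁ : ∀ k b → suc (k + (k + b)) * 2 ≡ suc (k * 2) + suc ((k + b) * 2)
  r-split₁ k b = solve (k ∷ b ∷ [])
  r-split₂ : ∀ k b → suc (k + (k + b)) * 2 ≡ 2 * suc (k * 2) + b * 2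
  r-split₂ k b = solve (k ∷ b ∷ [])

-- d = 3 + e and r = (m′+1)·d ≥ 16, in cross-multiplied form: split j = k + i with k = ⌊j/d⌋
-- and the row r − 1 = m′ + N with N = (m′+1)(d−1), and apply large-case.
third-large : ∀ m′ e j → let D = 3 + e; r = suc m′ * D in 15 < r → 2 ≤ j → 2 * j < r →
  (m′ C (j / D)) * (r ∸ 1) * (r ∸ j) ≤ (r ∸ 2 * j) * ((r ∸ 1) C j)
third-large m′ e j 15<r 2≤j 2j<r = subst₂ (λ x y → (m′ C k) * R * x ≤ u * (R C y)) k+i+u≡r∸j k+i≡j
  (large-case R m′ N k i u (row-split m′ e) (≤-pred 15<r) (2r≤3N m′ e) 2k≤i (subst (2 ≤_) (sym k+i≡j) 2≤j)
    (trans (cong (λ x → 2 * x + u) k+i≡j) 2j+u≡r) (m<n⇒0<n∸m 2j<r))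
  where
  D = 3 + e
  r = suc m′ * D
  R = r ∸ 1
  N = suc m′ * (2 + e)
  k = j / D
  i = j ∸ k
  u = r ∸ 2 * j
  row-split : ∀ m′ e → suc (suc e) + m′ * (3 + e) ≡ m′ + suc m′ * (2 + e)
  row-split m′ e = solve (m′ ∷ e ∷ [])
  2r≤3N : ∀ m′ e → 2 * (suc m′ * (3 + e)) ≤ 3 * (suc m′ * (2 + e))
  2r≤3N m′ e = ≤-surplus (suc m′ * e) (solve (m′ ∷ e ∷ []))
  k+i≡j : k + i ≡ j
  k+i≡j = m+[n∸m]≡n (m/n≤m j D)
  2j+u≡r : 2 * j + u ≡ r
  2j+u≡r = m+[n∸m]≡n (<⇒≤ 2j<r)
  k+i+u≡r∸j : k + i + u ≡ r ∸ j
  k+i+u≡r∸j = trans (cong (_+ u) k+i≡j) (sym (∸-from-sum {y = j} (trans (sym 2j+u≡r) (regroup j u))))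
    where
    regroup : ∀ j u → 2 * j + u ≡ j + (j + u)
    regroup j u = solve (j ∷ u ∷ [])
  2k≤i : 2 * k ≤ i
  2k≤i = +-cancelˡ-≤ k (2 * k) i (begin
    k + 2 * k   ≡⟨ three-k k ⟩
    k * 3       ≤⟨ *-monoʳ-≤ k (m≤m+n 3 e) ⟩
    k * D       ≤⟨ m/n*n≤m j D ⟩
    j           ≡⟨ sym k+i≡j ⟩
    k + i       ∎)
    where
    open ≤-Reasoning
    three-k : ∀ k → k + 2 * k ≡ k * 3
    three-k k = solve (k ∷ [])

third-cross : ∀ m e j → let D = 3 + e; r = m * D in 6 < r → 2 ≤ j → 2 * j < r → (2 * j ≡ r ∸ 1 → 9 < r) →
  ((r / D ∸ 1) C (j / D)) * (r ∸ 1) * (r ∸ j) ≤ (r ∸ 2 * j) * ((r ∸ 1) C j)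
third-cross (suc m′) e j 6<r 2≤j 2j<r central⇒9<r with suc m′ * (3 + e) ≤? 15
... | yes r≤15 = all-small (s≤s r≤15) e<13 j<16 (divides (suc m′) refl) 6<r 2≤j 2j<r central⇒9<r
  where
  e<13 : e < 13
  e<13 = ≤-pred (≤-pred (≤-trans (m≤m+n (3 + e) (m′ * (3 + e))) r≤15))
  j<16 : j < 16
  j<16 = m≤n⇒m≤1+n (≤-trans (j<r 2j<r) r≤15)
... | no r≰15 rewrite *-/-cancel (suc m′) (2 + e) = third-large m′ e j (≰⇒> r≰15) 2≤j 2j<r

-- Bridge to ℚ: (X/Y)·Z ≤ P/Q follows from the cross-multiplied inequality X·Z·Q ≤ P·Y.
-- The proof passes to unnormalised rationals, where ≤ is cross-multiplication.
ratio-bound : ∀ X Y Z P Q → 0 < Y → 0 < Q → X * Z * Q ≤ P * Y →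
  ratio X Y ℚ.* ratio Z 1 ℚ.≤ ratio P Q
ratio-bound X (suc y) Z P (suc q) _ _ XZQ≤PY = ℚP.toℚᵘ-cancel-≤ (ℚᵘP.≤-respˡ-≃ (ℚᵘP.≃-sym lhs≃) lhs≤rhs)
  where
  lhs≃ : ℚ.toℚᵘ (ratio X (suc y) ℚ.* ratio Z 1) ℚᵘ.≃ ℚᵘ.mkℚᵘ (ℤ.+ X) y ℚᵘ.* ℚᵘ.mkℚᵘ (ℤ.+ Z) 0
  lhs≃ = ℚᵘP.≃-trans (ℚP.toℚᵘ-homo-* (ratio X (suc y)) (ratio Z 1))
           (ℚᵘP.*-cong (ℚP.toℚᵘ-fromℚᵘ (ℚᵘ.mkℚᵘ (ℤ.+ X) y)) (ℚP.toℚᵘ-fromℚᵘ (ℚᵘ.mkℚᵘ (ℤ.+ Z) 0)))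
  lhs≤rhs : ℚᵘ.mkℚᵘ (ℤ.+ X) y ℚᵘ.* ℚᵘ.mkℚᵘ (ℤ.+ Z) 0 ℚᵘ.≤ ℚ.toℚᵘ (ratio P (suc q))
  lhs≤rhs = ℚᵘP.≤-respʳ-≃ (ℚᵘP.≃-sym (ℚP.toℚᵘ-fromℚᵘ (ℚᵘ.mkℚᵘ (ℤ.+ P) q)))
    (ℚᵘ.*≤* (subst₂ ℤ._≤_
      (trans (ℤP.pos-* (X * Z) (suc q)) (cong (ℤ._* (ℤ.+ suc q)) (ℤP.pos-* X Z)))
      (ℤP.pos-* P (suc y * 1))
      (ℤ.+≤+ (subst (X * Z * suc q ≤_) (cong (P *_) (sym (*-identityʳ (suc y)))) XZQ≤PY))))

scaled-bound : ∀ r d j .{{_ : NonZero d}} P Q → 2 * j < r → 0 < Q →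
  ((r / d ∸ 1) C (j / d)) * (r ∸ 1) * Q ≤ P * ((r ∸ 1) C j) → A r d j ℚ.* ratio (r ∸ 1) 1 ℚ.≤ ratio P Q
scaled-bound r d j P Q 2j<r =
  ratio-bound ((r / d ∸ 1) C (j / d)) ((r ∸ 1) C j) (r ∸ 1) P Q (C-pos (below-half {j} 2j<r))

lemma4p6 : (r d j : ℕ) → 6 < r → (1<d : 1 < d) → d ∣ r → 2 ≤ j → 2 * j < r
    → (2 * j ≡ r ∸ 1 → 9 < r)
    → let a = A r d j {{>-nonZero (<-trans z<s 1<d)}} ℚ.* ratio (r ∸ 1) 1 in
      (d ≡ 2 → 2 ∣ j → a ℚ.≤ ℚ.1ℚ)
      × (d ≡ 2 → ¬ (2 ∣ j) → a ℚ.≤ ratio (3 * (r ∸ 2 * j)) (2 * (r ∸ j)))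
      × (2 < d → a ℚ.≤ ratio (r ∸ 2 * j) (r ∸ j))
lemma4p6 _ 1 _ _ (s≤s ()) _ _ _ _
lemma4p6 _ 2 j _ _ (divides m refl) 2≤j 2j<r _ =
    (λ _ 2∣j → scaled-bound (m * 2) 2 j 1 1 2j<r z<s (even-cross m j 2≤j 2j<r 2∣j))
  , (λ _ ¬2∣j → scaled-bound (m * 2) 2 j (3 * (m * 2 ∸ 2 * j)) (2 * (m * 2 ∸ j)) 2j<r
       (*-monoʳ-< 2 (m<n⇒0<n∸m (j<r {j} 2j<r)))
       (odd-cross m (j / 2) j (odd-form j ¬2∣j) 2≤j 2j<r))
  , λ { (s≤s (s≤s ())) }
lemma4p6 _ d@(suc (suc (suc e))) j 6<r _ (divides m refl) 2≤j 2j<r central⇒9<r =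
    (λ ()) , (λ ())
  , λ _ → scaled-bound (m * d) d j (m * d ∸ 2 * j) (m * d ∸ j) 2j<r (m<n⇒0<n∸m (j<r {j} 2j<r))
      (third-cross m e j 6<r 2≤j 2j<r central⇒9<r)
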